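{- Let $n$ be an odd positive integer which is either near superperfect or deficient superperfect. Then $\sigma(n)=2^k m^2$ for some integer $k\ge0$ and some odd positive integer $m$.
   Context: $\sigma(m)$ denotes the sum of the positive divisors of $m$. A positive integer $n$ is near superperfect if $2n+d=\sigma(\sigma(n))$ for some positive divisor $d$ of $n$, and deficient superperfect if $2n-d=\sigma(\sigma(n))$ for some positive divisor $d$ of $n$. -}

module Defs where

open import Data.Nat using (ℕ; zero; suc; _+_; _*_; _^_; _<_)
open import Data.Nat.Divisibility using (_∣_; _∣?_)
open import Data.List using (filter; upTo; map)
open import Data.Nat.ListAction using (sum)
open import Data.Product using (∃-syntax; _×_)
open import Relation.Binary.PropositionalEquality using (_≡_)

σ : ℕ → ℕ
σ m = sum (filter (_∣? m) (map suc (upTo m)))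

NearSuperperfect : ℕ → Set
NearSuperperfect n = ∃[ d ] (0 < d × d ∣ n × 2 * n + d ≡ σ (σ n))

-- deficient superperfect: 2n - d = σ(σ(n)) for some positive divisor d of n
-- (written as 2n = σ(σ(n)) + d to avoid truncated subtraction; equivalent over ℤ)
DeficientSuperperfect : ℕ → Set
DeficientSuperperfect n = ∃[ d ] (0 < d × d ∣ n × 2 * n ≡ σ (σ n) + d)

Odd : ℕ → Set
Odd n = ∃[ j ] (n ≡ 1 + 2 * j)

-- An odd n has only odd divisors d, so near or deficient superperfection gives
-- σ (σ n) ≡ d ≡ 1 (mod 2). For N = 2^k M with M odd, σ N is congruent mod 2 to the
-- number of odd divisors of N, that is, of divisors a of M; these correspond to the
-- ordered factorisations a b = M, which pair off under (a , b) ↦ (b , a) except on the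
-- diagonal a = b. So σ N odd forces M to be a square; apply this to N = σ n.
module Submission where

open import Data.Bool using (true; false; if_then_else_)
open import Data.Fin using (Fin; zero; suc; toℕ; fromℕ<; punchIn)
open import Data.Fin.Properties using (any?; toℕ-injective; toℕ-fromℕ<; punchInᵢ≢i; <-cmp)
  renaming (_<?_ to _<ᶠ?_)
open import Data.List using ([]; _∷_; filter; map; upTo; applyUpTo)
open import Data.List.Properties using (map-upTo; map-applyUpTo)
import Data.Nat.ListAction as List
open import Data.Nat using (ℕ; zero; suc; _+_; _*_; _^_; _<_; _≤_; z≤n; s≤s; z<s; _≟_)
open import Data.Nat.Properties
  using ( +-comm; +-suc; +-identityʳ; *-comm; *-assoc; *-identityˡ; *-cancelˡ-≡; suc-injective
        ; ≤-trans; >⇒≢; m≤m*n; m≤n*m; m<m*n; m^n≢0; +-0-commutativeMonoid)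
open import Algebra.Properties.CommutativeMonoid.Sum +-0-commutativeMonoid
  using (sum; sum-syntax; sum-cong-≗; sum-replicate-zero; sum-remove; ∑-distrib-+; ∑-comm)
open import Data.Nat.Divisibility
  using ( _∣_; divides; _∣?_; _∣0; ∣-refl; ∣-trans; ∣⇒≤; 0∣⇒≡0; ∣1⇒≡1
        ; m∣m*n; ∣m⇒∣m*n; ∣n⇒∣m*n; ∣m∣n⇒∣m+n; ∣m+n∣m⇒∣n)
open import Data.Nat.Coprimality using (Coprime; coprime-divisor)
open import Data.Nat.Induction using (<-rec)
open import Data.Product using (∃-syntax; _×_; _,_)
open import Data.Sum using (_⊎_; inj₁; inj₂)
open import Data.Vec.Functional using (removeAt)
open import Function using (_∘_)
open import Relation.Binary.Definitions using (tri<; tri≈; tri>)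
open import Relation.Binary.PropositionalEquality
  using (_≡_; _≢_; refl; sym; trans; cong; cong₂; subst; module ≡-Reasoning)
open import Relation.Nullary using (¬_; Dec; yes; no; does; contradiction)
open import Relation.Nullary.Decidable using (_×-dec_; ¬?)

open import Defs

private variable
  n d m : ℕ

𝟙 : {P : Set} → Dec P → ℕ
𝟙 P? = if does P? then 1 else 0

𝟙-yes : {P : Set} (P? : Dec P) → P → 𝟙 P? ≡ 1
𝟙-yes (yes _) _ = refl
𝟙-yes (no ¬p) p = contradiction p ¬p

𝟙-no : {P : Set} (P? : Dec P) → ¬ P → 𝟙 P? ≡ 0
𝟙-no (yes p) ¬p = contradiction p ¬p
𝟙-no (no _)  _  = refl

𝟙-cong : {P Q : Set} (P? : Dec P) (Q? : Dec Q) → (P → Q) → (Q → P) → 𝟙 P? ≡ 𝟙 Q?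
𝟙-cong (yes p) Q? to _    = sym (𝟙-yes Q? (to p))
𝟙-cong (no ¬p) Q? _  from = sym (𝟙-no Q? (¬p ∘ from))

≡𝟙 : {P : Set} (P? : Dec P) {x : ℕ} → (P → x ≡ 1) → (¬ P → x ≡ 0) → x ≡ 𝟙 P?
≡𝟙 (yes p) x≡1 _   = x≡1 p
≡𝟙 (no ¬p) _   x≡0 = x≡0 ¬p

Odd⇒¬2∣ : Odd n → ¬ 2 ∣ n
Odd⇒¬2∣ (j , refl) 2∣1+2j = contradiction (∣1⇒≡1 (∣m+n∣m⇒∣n 2∣2j+1 (m∣m*n j))) λ ()
  where
  2∣2j+1 : 2 ∣ 2 * j + 1
  2∣2j+1 = subst (2 ∣_) (+-comm 1 (2 * j)) 2∣1+2j

Odd⇒2∣suc : Odd n → 2 ∣ suc n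
Odd⇒2∣suc (j , refl) = divides (suc j) (cong (2 +_) (*-comm 2 j))

2∣⊎Odd : ∀ n → 2 ∣ n ⊎ Odd n
2∣⊎Odd zero          = inj₁ (divides 0 refl)
2∣⊎Odd (suc zero)    = inj₂ (0 , refl)
2∣⊎Odd (suc (suc n)) with 2∣⊎Odd n
... | inj₁ 2∣n        = inj₁ (∣m∣n⇒∣m+n ∣-refl 2∣n)
... | inj₂ (j , refl) = inj₂ (suc j , cong (2 +_) (sym (+-suc j (j + 0))))

¬2∣⇒Odd : ¬ 2 ∣ n → Odd n
¬2∣⇒Odd {n} ¬2∣n with 2∣⊎Odd n
... | inj₁ 2∣n = contradiction 2∣n ¬2∣n
... | inj₂ odd = odd

¬2∣⇒nonZero : ¬ 2 ∣ n → 0 < n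
¬2∣⇒nonZero {zero}  ¬2∣0 = contradiction (divides 0 refl) ¬2∣0
¬2∣⇒nonZero {suc n} _    = z<s

¬2∣⇒coprime-2 : ¬ 2 ∣ d → Coprime d 2
¬2∣⇒coprime-2 _    {zero}              (_ , 0∣2) with 0∣⇒≡0 0∣2
... | ()
¬2∣⇒coprime-2 _    {suc zero}          _         = refl
¬2∣⇒coprime-2 ¬2∣d {suc (suc zero)}    (2∣d , _) = contradiction 2∣d ¬2∣d
¬2∣⇒coprime-2 _    {suc (suc (suc i))} (_ , i∣2) with ∣⇒≤ i∣2
... | s≤s (s≤s ())

¬2∣∧∣2^k*⇒∣ : ∀ k → ¬ 2 ∣ d → d ∣ 2 ^ k * m → d ∣ m
¬2∣∧∣2^k*⇒∣ {d} {m} zero    _    d∣m = subst (d ∣_) (*-identityˡ m) d∣m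
¬2∣∧∣2^k*⇒∣ {d} {m} (suc k) ¬2∣d d∣2^k+1*m =
  ¬2∣∧∣2^k*⇒∣ k ¬2∣d (coprime-divisor (¬2∣⇒coprime-2 ¬2∣d)
                                       (subst (d ∣_) (*-assoc 2 (2 ^ k) m) d∣2^k+1*m))

2^k*odd-decomposition : ∀ n → 0 < n → ∃[ k ] ∃[ m ] (¬ 2 ∣ m × n ≡ 2 ^ k * m)
2^k*odd-decomposition = <-rec _ split
  where
  split : ∀ n → (∀ {n′} → n′ < n → 0 < n′ → ∃[ k ] ∃[ m ] (¬ 2 ∣ m × n′ ≡ 2 ^ k * m)) →
          0 < n → ∃[ k ] ∃[ m ] (¬ 2 ∣ m × n ≡ 2 ^ k * m)
  split n rec 0<n with 2 ∣? n
  ... | no ¬2∣n = 0 , n , ¬2∣n , sym (*-identityˡ n)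
  ... | yes (divides zero n≡0) = contradiction n≡0 (>⇒≢ 0<n)
  ... | yes (divides q@(suc _) n≡q*2) with rec q<n z<s
    where
    q<n : q < n
    q<n = subst (q <_) (sym n≡q*2) (m<m*n q 2 (s≤s (s≤s z≤n)))
  ...   | k , m , ¬2∣m , q≡2^k*m = suc k , m , ¬2∣m , (begin
    n               ≡⟨ n≡q*2 ⟩
    q * 2           ≡⟨ *-comm q 2 ⟩
    2 * q           ≡⟨ cong (2 *_) q≡2^k*m ⟩
    2 * (2 ^ k * m) ≡⟨ *-assoc 2 (2 ^ k) m ⟨
    2 ^ suc k * m   ∎)
    where open ≡-Reasoning

∀∣⇒∣∑ : ∀ {n} (f : Fin n → ℕ) → (∀ i → d ∣ f i) → d ∣ ∑[ i < n ] f i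
∀∣⇒∣∑ {d} {zero}  f _   = d ∣0
∀∣⇒∣∑ {d} {suc n} f d∣f = ∣m∣n⇒∣m+n (d∣f zero) (∀∣⇒∣∑ (f ∘ suc) (d∣f ∘ suc))

∑-single : ∀ {n} (f : Fin n → ℕ) i → (∀ j → j ≢ i → f j ≡ 0) → ∑[ j < n ] f j ≡ f i
∑-single {suc n} f i vanish = begin
  sum f                    ≡⟨ sum-remove {i = i} f ⟩
  f i + sum (removeAt f i) ≡⟨ cong (f i +_) (sum-cong-≗ (λ j → vanish (punchIn i j) (punchInᵢ≢i i j))) ⟩
  f i + ∑[ j < n ] 0       ≡⟨ cong (f i +_) (sum-replicate-zero n) ⟩
  f i + 0                  ≡⟨ +-identityʳ (f i) ⟩
  f i                      ∎
  where open ≡-Reasoning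

∑∑-symmetric-even : ∀ {n} (f : Fin n → Fin n → ℕ) → (∀ i j → f i j ≡ f j i) → (∀ i → f i i ≡ 0) →
                    2 ∣ ∑[ i < n ] ∑[ j < n ] f i j
∑∑-symmetric-even {n} f f-sym f-diag = divides U (begin
  ∑[ i < n ] ∑[ j < n ] f i j
    ≡⟨ sum-cong-≗ (λ i → sum-cong-≗ (split i)) ⟩
  ∑[ i < n ] ∑[ j < n ] (upper i j + upper j i)
    ≡⟨ sum-cong-≗ (λ i → ∑-distrib-+ (upper i) (λ j → upper j i)) ⟩
  ∑[ i < n ] (∑[ j < n ] upper i j + ∑[ j < n ] upper j i)
    ≡⟨ ∑-distrib-+ (λ i → ∑[ j < n ] upper i j) _ ⟩
  U + ∑[ i < n ] ∑[ j < n ] upper j i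
    ≡⟨ cong (U +_) (∑-comm (λ i j → upper j i)) ⟩
  U + U
    ≡⟨ cong (U +_) (+-identityʳ U) ⟨
  2 * U
    ≡⟨ *-comm 2 U ⟩
  U * 2
    ∎)
  where
  open ≡-Reasoning
  upper : Fin n → Fin n → ℕ
  upper i j = 𝟙 (i <ᶠ? j) * f i j
  U : ℕ
  U = ∑[ i < n ] ∑[ j < n ] upper i j
  upper-< : ∀ {i j} → toℕ i < toℕ j → upper i j ≡ f i j
  upper-< {i} {j} i<j = trans (cong (_* f i j) (𝟙-yes (i <ᶠ? j) i<j)) (*-identityˡ (f i j))
  upper-≮ : ∀ {i j} → ¬ toℕ i < toℕ j → upper i j ≡ 0
  upper-≮ {i} {j} i≮j = cong (_* f i j) (𝟙-no (i <ᶠ? j) i≮j)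
  split : ∀ i j → f i j ≡ upper i j + upper j i
  split i j with <-cmp i j
  ... | tri< i<j _ j≮i  = sym (trans (cong₂ _+_ (upper-< i<j) (upper-≮ j≮i)) (+-identityʳ (f i j)))
  ... | tri≈ i≮i refl _ = sym (trans (cong₂ _+_ (upper-≮ i≮i) (upper-≮ i≮i)) (sym (f-diag i)))
  ... | tri> i≮j _ j<i  = sym (trans (cong₂ _+_ (upper-≮ i≮j) (upper-< j<i)) (f-sym j i))

∑-cofactor-indicator : ∀ {n m} d → 0 < m → m ≤ n →
                       ∑[ j < n ] 𝟙 (suc d * suc (toℕ j) ≟ m) ≡ 𝟙 (suc d ∣? m)
∑-cofactor-indicator {n} {m} d 0<m m≤n = ≡𝟙 (suc d ∣? m) one-cofactor no-cofactor
  where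
  no-cofactor : ¬ suc d ∣ m → ∑[ j < n ] 𝟙 (suc d * suc (toℕ j) ≟ m) ≡ 0
  no-cofactor d∤m = trans (sum-cong-≗ {n} (λ j → 𝟙-no (suc d * suc (toℕ j) ≟ m) (d∤m ∘ cofactor⇒∣ j)))
                          (sum-replicate-zero n)
    where
    cofactor⇒∣ : ∀ j → suc d * suc (toℕ j) ≡ m → suc d ∣ m
    cofactor⇒∣ j e = divides (suc (toℕ j)) (trans (sym e) (*-comm (suc d) (suc (toℕ j))))
  one-cofactor : suc d ∣ m → ∑[ j < n ] 𝟙 (suc d * suc (toℕ j) ≟ m) ≡ 1
  one-cofactor (divides zero m≡0) = contradiction m≡0 (>⇒≢ 0<m)
  one-cofactor (divides (suc q) m≡[1+q][1+d]) =
    trans (∑-single _ c others-vanish) (𝟙-yes (suc d * suc (toℕ c) ≟ m) c-cofactor)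
    where
    q<n : q < n
    q<n = ≤-trans (subst (suc q ≤_) (sym m≡[1+q][1+d]) (m≤m*n (suc q) (suc d))) m≤n
    c : Fin n
    c = fromℕ< q<n
    c-cofactor : suc d * suc (toℕ c) ≡ m
    c-cofactor = begin
      suc d * suc (toℕ c) ≡⟨ cong (λ t → suc d * suc t) (toℕ-fromℕ< q<n) ⟩
      suc d * suc q       ≡⟨ *-comm (suc d) (suc q) ⟩
      suc q * suc d       ≡⟨ m≡[1+q][1+d] ⟨
      m                   ∎
      where open ≡-Reasoning
    others-vanish : ∀ j → j ≢ c → 𝟙 (suc d * suc (toℕ j) ≟ m) ≡ 0
    others-vanish j j≢c = 𝟙-no (suc d * suc (toℕ j) ≟ m) λ j-cofactor →
      j≢c (toℕ-injective (suc-injective (*-cancelˡ-≡ _ _ (suc d) (trans j-cofactor (sym c-cofactor)))))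

σ-term : ℕ → ℕ → ℕ
σ-term n d = if does (d ∣? n) then d else 0

sum-filter : ∀ {P : ℕ → Set} (P? : ∀ x → Dec (P x)) xs →
             List.sum (filter P? xs) ≡ List.sum (map (λ x → if does (P? x) then x else 0) xs)
sum-filter P? []       = refl
sum-filter P? (x ∷ xs) with does (P? x)
... | true  = cong (x +_) (sum-filter P? xs)
... | false = sum-filter P? xs

sum-applyUpTo : ∀ (f : ℕ → ℕ) n → List.sum (applyUpTo f n) ≡ ∑[ i < n ] f (toℕ i)
sum-applyUpTo f zero    = refl
sum-applyUpTo f (suc n) = cong (f 0 +_) (sum-applyUpTo (f ∘ suc) n)

σ≡∑σ-term : ∀ n → σ n ≡ ∑[ i < n ] σ-term n (suc (toℕ i))
σ≡∑σ-term n = begin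
  List.sum (filter (_∣? n) (map suc (upTo n)))     ≡⟨ cong (List.sum ∘ filter (_∣? n)) (map-upTo suc n) ⟩
  List.sum (filter (_∣? n) (applyUpTo suc n))      ≡⟨ sum-filter (_∣? n) (applyUpTo suc n) ⟩
  List.sum (map (σ-term n) (applyUpTo suc n))      ≡⟨ cong List.sum (map-applyUpTo suc (σ-term n) n) ⟩
  List.sum (applyUpTo (σ-term n ∘ suc) n)          ≡⟨ sum-applyUpTo (σ-term n ∘ suc) n ⟩
  ∑[ i < n ] σ-term n (suc (toℕ i))                ∎
  where open ≡-Reasoning

odd-divisor? : ∀ n d → Dec (d ∣ n × ¬ 2 ∣ d)
odd-divisor? n d = d ∣? n ×-dec ¬? (2 ∣? d)

2∣[P∧¬2∣d]+[P]d : ∀ {P : Set} (P? : Dec P) (2∣d? : Dec (2 ∣ d)) →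
                  2 ∣ 𝟙 (P? ×-dec ¬? 2∣d?) + (if does P? then d else 0)
2∣[P∧¬2∣d]+[P]d (no _)  _         = divides 0 refl
2∣[P∧¬2∣d]+[P]d (yes _) (yes 2∣d) = 2∣d
2∣[P∧¬2∣d]+[P]d (yes _) (no ¬2∣d) = Odd⇒2∣suc (¬2∣⇒Odd ¬2∣d)

module _ {n k m} (n≡2^k*m : n ≡ 2 ^ k * m) (¬2∣m : ¬ 2 ∣ m) where

  factorisations : Fin n → Fin n → ℕ
  factorisations i j = 𝟙 (suc (toℕ i) * suc (toℕ j) ≟ m)

  factorisations-sym : ∀ i j → factorisations i j ≡ factorisations j i
  factorisations-sym i j = 𝟙-cong (a * b ≟ m) (b * a ≟ m) (trans (*-comm b a)) (trans (*-comm a b))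
    where
    a b : ℕ
    a = suc (toℕ i)
    b = suc (toℕ j)

  odd-divisor⇒∣odd-part : d ∣ n × ¬ 2 ∣ d → d ∣ m
  odd-divisor⇒∣odd-part {d} (d∣n , ¬2∣d) = ¬2∣∧∣2^k*⇒∣ k ¬2∣d (subst (d ∣_) n≡2^k*m d∣n)

  ∣odd-part⇒odd-divisor : d ∣ m → d ∣ n × ¬ 2 ∣ d
  ∣odd-part⇒odd-divisor {d} d∣m =
    subst (d ∣_) (sym n≡2^k*m) (∣n⇒∣m*n (2 ^ k) d∣m) , λ 2∣d → ¬2∣m (∣-trans 2∣d d∣m)

  ∑-factorisations : ∀ i → ∑[ j < n ] factorisations i j ≡ 𝟙 (odd-divisor? n (suc (toℕ i)))
  ∑-factorisations i = trans (∑-cofactor-indicator (toℕ i) (¬2∣⇒nonZero ¬2∣m) m≤n)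
                             (𝟙-cong (suc (toℕ i) ∣? m) (odd-divisor? n (suc (toℕ i)))
                                     ∣odd-part⇒odd-divisor odd-divisor⇒∣odd-part)
    where
    m≤n : m ≤ n
    m≤n = subst (m ≤_) (sym n≡2^k*m) (m≤n*m m (2 ^ k) {{m^n≢0 2 k}})

  2∣∑∑factorisations+σ : 2 ∣ ∑[ i < n ] ∑[ j < n ] factorisations i j + σ n
  2∣∑∑factorisations+σ = subst (2 ∣_) sum-split
    (∀∣⇒∣∑ {n = n} _ (λ i → 2∣[P∧¬2∣d]+[P]d (suc (toℕ i) ∣? n) (2 ∣? suc (toℕ i))))
    where
    open ≡-Reasoning
    sum-split : ∑[ i < n ] (𝟙 (odd-divisor? n (suc (toℕ i))) + σ-term n (suc (toℕ i)))
              ≡ ∑[ i < n ] ∑[ j < n ] factorisations i j + σ n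
    sum-split = begin
      ∑[ i < n ] (𝟙 (odd-divisor? n (suc (toℕ i))) + σ-term n (suc (toℕ i)))
        ≡⟨ ∑-distrib-+ {n} (λ i → 𝟙 (odd-divisor? n (suc (toℕ i)))) (λ i → σ-term n (suc (toℕ i))) ⟩
      ∑[ i < n ] 𝟙 (odd-divisor? n (suc (toℕ i))) + ∑[ i < n ] σ-term n (suc (toℕ i))
        ≡⟨ cong₂ _+_ (sum-cong-≗ {n} (λ i → sym (∑-factorisations i))) (sym (σ≡∑σ-term n)) ⟩
      ∑[ i < n ] ∑[ j < n ] factorisations i j + σ n
        ∎

  σ-odd⇒odd-part-square : ¬ 2 ∣ σ n → ∃[ r ] (r * r ≡ m)
  σ-odd⇒odd-part-square ¬2∣σn with any? (λ i → suc (toℕ i) * suc (toℕ i) ≟ m)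
  ... | yes (i , square) = suc (toℕ i) , square
  ... | no no-square     = contradiction (∣m+n∣m⇒∣n 2∣∑∑factorisations+σ 2∣∑∑factorisations) ¬2∣σn
    where
    2∣∑∑factorisations : 2 ∣ ∑[ i < n ] ∑[ j < n ] factorisations i j
    2∣∑∑factorisations = ∑∑-symmetric-even factorisations factorisations-sym
      (λ i → 𝟙-no (suc (toℕ i) * suc (toℕ i) ≟ m) (λ square → no-square (i , square)))

σ-odd⇒2^k*odd-square : ∀ n → ¬ 2 ∣ σ n → ∃[ k ] ∃[ r ] (0 < r × Odd r × n ≡ 2 ^ k * (r * r))
σ-odd⇒2^k*odd-square zero      ¬2∣σ0 = contradiction (divides 0 refl) ¬2∣σ0
σ-odd⇒2^k*odd-square n@(suc _) ¬2∣σn with 2^k*odd-decomposition n z<s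
... | k , m , ¬2∣m , n≡2^k*m with σ-odd⇒odd-part-square {k = k} n≡2^k*m ¬2∣m ¬2∣σn
...   | r , r*r≡m = k , r , ¬2∣⇒nonZero ¬2∣r , ¬2∣⇒Odd ¬2∣r , trans n≡2^k*m (cong (2 ^ k *_) (sym r*r≡m))
  where
  ¬2∣r : ¬ 2 ∣ r
  ¬2∣r 2∣r = ¬2∣m (subst (2 ∣_) r*r≡m (∣m⇒∣m*n r 2∣r))

near∨deficientSuperperfect⇒σσ-odd : Odd n → NearSuperperfect n ⊎ DeficientSuperperfect n → ¬ 2 ∣ σ (σ n)
near∨deficientSuperperfect⇒σσ-odd {n} odd-n (inj₁ (d , _ , d∣n , 2n+d≡σσn)) 2∣σσn =
  Odd⇒¬2∣ odd-n (∣-trans (∣m+n∣m⇒∣n (subst (2 ∣_) (sym 2n+d≡σσn) 2∣σσn) (m∣m*n n)) d∣n)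
near∨deficientSuperperfect⇒σσ-odd {n} odd-n (inj₂ (d , _ , d∣n , 2n≡σσn+d)) 2∣σσn =
  Odd⇒¬2∣ odd-n (∣-trans (∣m+n∣m⇒∣n (subst (2 ∣_) 2n≡σσn+d (m∣m*n n)) 2∣σσn) d∣n)

mainTheorem7 : (n : ℕ) → 0 < n → Odd n → NearSuperperfect n ⊎ DeficientSuperperfect n →
    ∃[ k ] ∃[ m ] (0 < m × Odd m × σ n ≡ 2 ^ k * (m * m))
mainTheorem7 n _ odd-n superperfect =
  σ-odd⇒2^k*odd-square (σ n) (near∨deficientSuperperfect⇒σσ-odd odd-n superperfect)
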